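{- Let $t$ be a finite tree and $D$ a WMSO-definable $K$-sparse distribution over $t$. Then there exists a WMSO-definable flow $f$ that is compatible with $D$, bounded by $2K+1$, and such that for each node $x$ there is a zone $Z_x$ with least element $x$ and frontier $F_x$ satisfying (1) $D(Z_x)+f(x)=|Z_x|+K(|F_x|-1)$, and (2) $f(y)\ge K$ for all $y\in F_x$ with $y\neq x$.
   Context: A tree is a partial map $t:\{0,1\}^*\to\Sigma$ with prefix-closed domain; throughout, every node $u$ either has both children $u0,u1$ in $\mathit{dom}(t)$ (inner node) or neither (leaf). $\sqsubseteq$ is the prefix order. A zone is a connected subset $Z\subseteq\mathit{dom}(t)$ (it has a least element $x$ and $x\sqsubseteq y\sqsubseteq z$ with $x,z\in Z$ implies $y\in Z$); its frontier is $\{x,x_1,\dots,x_n\}$ where $x$ is its least element and $x_1,\dots,x_n$ are the minimal nodes below $x$ not in $Z$. A distribution is a map $D:\mathit{dom}(t)\to\mathbb{N}$, with $D(Z)=\sum_{x\in Z}D(x)$; it is $K$-sparse if $D(Z)\le|Z|+K|F|$ for every finite zone $Z$ of frontier $F$. A flow is a map $f:\mathit{dom}(t)\to\mathbb{Z}$; it is compatible with $D$ if $D(x)+f(x)\le 1+f(x0)+f(x1)$ for all inner nodes $x$ and $D(x)+f(x)\le1$ for all leaves $x$; it is bounded by $K$ if $|f(x)|\le K$ for all $x$. WMSO is MSO with set variables ranging over finite sets. A map $g:\mathit{dom}(t)\to I$ with $I\subseteq\mathbb{Z}$ finite is WMSO-definable if for each $i\in I$ there is a WMSO formula $\phi_i(x)$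 with $g(u)=i$ iff $t\models\phi_i(u)$. -}

module Defs where

open import Data.Nat using (ℕ; suc; _+_; _*_; _≤_)
open import Data.Integer as ℤ using (ℤ; +_; ∣_∣)
open import Data.Fin using (Fin; zero; suc)
open import Data.List using (List; []; _∷_; length; map)
open import Data.Nat.ListAction using (sum)
open import Data.List.Membership.Propositional using (_∈_; _∉_)
open import Data.List.Relation.Unary.Unique.Propositional using (Unique)
open import Data.Product using (Σ; _×_; ∃)
open import Data.Sum using (_⊎_)
open import Relation.Nullary using (¬_)
open import Relation.Binary.PropositionalEquality using (_≡_; _≢_)

-- Finite trees over an alphabet A in which every node has 0 or 2 children.
-- (A finite partial map {0,1}* → A with prefix-closed domain, each node
-- having both children or none, is exactly such a tree.)

data Tree (A : Set) : Set where
  leaf : A → Tree A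
  node : A → Tree A → Tree A → Tree A

-- Nodes of t (= dom(t)): 'here' is the empty word, go0/go1 prepend 0/1.
data Pos {A : Set} : Tree A → Set where
  here : ∀ {t} → Pos t
  go0  : ∀ {a l r} → Pos l → Pos (node a l r)
  go1  : ∀ {a l r} → Pos r → Pos (node a l r)

label : ∀ {A} (t : Tree A) → Pos t → A
label (leaf a)     here    = a
label (node a l r) here    = a
label (node a l r) (go0 p) = label l p
label (node a l r) (go1 p) = label r p

data _⊑_ {A : Set} : {t : Tree A} → Pos t → Pos t → Set where
  ⊑-here : ∀ {t} {p : Pos t} → here ⊑ p
  ⊑-0 : ∀ {a l r} {p q : Pos l} → p ⊑ q → go0 {a = a} {r = r} p ⊑ go0 q
  ⊑-1 : ∀ {a l r} {p q : Pos r} → p ⊑ q → go1 {a = a} {l = l} p ⊑ go1 q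

_⊏_ : ∀ {A} {t : Tree A} → Pos t → Pos t → Set
p ⊏ q = p ⊑ q × p ≢ q

data Child0 {A : Set} : {t : Tree A} → Pos t → Pos t → Set where
  c-here : ∀ {a l r} → Child0 (here {t = node a l r}) (go0 here)
  c-0 : ∀ {a l r} {p q : Pos l} → Child0 p q → Child0 (go0 {a = a} {r = r} p) (go0 q)
  c-1 : ∀ {a l r} {p q : Pos r} → Child0 p q → Child0 (go1 {a = a} {l = l} p) (go1 q)

data Child1 {A : Set} : {t : Tree A} → Pos t → Pos t → Set where
  c-here : ∀ {a l r} → Child1 (here {t = node a l r}) (go1 here)
  c-0 : ∀ {a l r} {p q : Pos l} → Child1 p q → Child1 (go0 {a = a} {r = r} p) (go0 q)
  c-1 : ∀ {a l r} {p q : Pos r} → Child1 p q → Child1 (go1 {a = a} {l = l} p) (go1 q)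

data IsLeaf {A : Set} : {t : Tree A} → Pos t → Set where
  l-here : ∀ {a} → IsLeaf (here {t = leaf a})
  l-0 : ∀ {a l r} {p : Pos l} → IsLeaf p → IsLeaf (go0 {a = a} {r = r} p)
  l-1 : ∀ {a l r} {p : Pos r} → IsLeaf p → IsLeaf (go1 {a = a} {l = l} p)

-- Zones and frontiers.  Finite sets of nodes are duplicate-free lists.

IsZone : ∀ {A} {t : Tree A} → Pos t → List (Pos t) → Set
IsZone {t = t} x Z =
  Unique Z × x ∈ Z × (∀ z → z ∈ Z → x ⊑ z)
  × (∀ (u y z : Pos t) → u ∈ Z → z ∈ Z → u ⊑ y → y ⊑ z → y ∈ Z)

InFrontier : ∀ {A} {t : Tree A} → Pos t → List (Pos t) → Pos t → Set
InFrontier {t = t} x Z y =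
  y ≡ x ⊎ (x ⊑ y × y ∉ Z × ¬ (Σ (Pos t) λ w → x ⊑ w × w ⊏ y × w ∉ Z))

IsFrontier : ∀ {A} {t : Tree A} → Pos t → List (Pos t) → List (Pos t) → Set
IsFrontier {t = t} x Z F =
  Unique F × (∀ y → (y ∈ F → InFrontier x Z y) × (InFrontier x Z y → y ∈ F))

mass : ∀ {A} {t : Tree A} → (Pos t → ℕ) → List (Pos t) → ℕ
mass D Z = sum (map D Z)

-- K-sparse distribution (t is finite, so every zone is finite).
Sparse : ∀ {A} (t : Tree A) → ℕ → (Pos t → ℕ) → Set
Sparse t K D = ∀ (x : Pos t) (Z F : List (Pos t)) →
  IsZone x Z → IsFrontier x Z F → mass D Z ≤ length Z + K * length F

Compatible : ∀ {A} (t : Tree A) → (Pos t → ℕ) → (Pos t → ℤ) → Set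
Compatible t D f =
  (∀ (x y z : Pos t) → Child0 x y → Child1 x z →
     (+ D x) ℤ.+ f x ℤ.≤ (+ 1) ℤ.+ f y ℤ.+ f z)
  × (∀ (x : Pos t) → IsLeaf x → (+ D x) ℤ.+ f x ℤ.≤ + 1)

BoundedBy : ∀ {A} (t : Tree A) → ℕ → (Pos t → ℤ) → Set
BoundedBy t K f = ∀ x → ∣ f x ∣ ≤ K

-- WMSO over trees: n first-order variables, m (finite) set variables.

data Formula (A : Set) (n m : ℕ) : Set where
  lab    : A → Fin n → Formula A n m
  child0 : Fin n → Fin n → Formula A n m
  child1 : Fin n → Fin n → Formula A n m
  equal  : Fin n → Fin n → Formula A n m
  member : Fin n → Fin m → Formula A n m
  neg    : Formula A n m → Formula A n m
  conj   : Formula A n m → Formula A n m → Formula A n m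
  ex1    : Formula A (suc n) m → Formula A n m
  ex2    : Formula A n (suc m) → Formula A n m

ext : ∀ {n} {X : Set} → (Fin n → X) → X → Fin (suc n) → X
ext ρ v zero    = v
ext ρ v (suc i) = ρ i

Sat : ∀ {A n m} (t : Tree A) → Formula A n m →
      (Fin n → Pos t) → (Fin m → List (Pos t)) → Set
Sat t (lab a i)      ρ σ = label t (ρ i) ≡ a
Sat t (child0 i j)   ρ σ = Child0 (ρ i) (ρ j)
Sat t (child1 i j)   ρ σ = Child1 (ρ i) (ρ j)
Sat t (equal i j)    ρ σ = ρ i ≡ ρ j
Sat t (member i k)   ρ σ = ρ i ∈ σ k
Sat t (neg φ)        ρ σ = ¬ Sat t φ ρ σ
Sat t (conj φ ψ)     ρ σ = Sat t φ ρ σ × Sat t ψ ρ σ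
Sat t (ex1 φ)        ρ σ = Σ (Pos t) λ v → Sat t φ (ext ρ v) σ
Sat t (ex2 φ)        ρ σ = Σ (List (Pos t)) λ S → Sat t φ ρ (ext σ S)

noSets : ∀ {A} {t : Tree A} → Fin 0 → List (Pos t)
noSets ()

WMSODefinable : ∀ {A B : Set} (t : Tree A) → (Pos t → B) → Set
WMSODefinable {A} {B} t g =
  Σ (List B) λ I → (∀ u → g u ∈ I) ×
    (∀ i → i ∈ I → Σ (Formula A 1 0) λ φ → ∀ (u : Pos t) →
       (Sat t φ (λ _ → u) noSets → g u ≡ i) × (g u ≡ i → Sat t φ (λ _ → u) noSets))

{-# OPTIONS --safe #-}
module Submission where

-- The flow is computed bottom-up: a node passes to its parent
-- f(x) = 1 − D(x) + min(f(x0), K) + min(f(x1), K), which is compatible with D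
-- because of the slack in the two minima, and is at most 1 + 2K.  The zone Z_x
-- consists of x and every node reached from x through children whose flow is
-- at most K; its frontier below x consists of the first nodes with flow above K.
-- Telescoping the recursion over Z_x, where every frontier node below x
-- contributes exactly K, gives D(Z_x) + f(x) = |Z_x| + K(|F_x| − 1); sparsity
-- of D on Z_x then bounds f(x) below by −K.  Finally, on a finite tree every
-- node is WMSO-definable by its address, hence so is every function.

open import Defs
open import Data.Bool using (Bool; true; false)
open import Data.Empty using (⊥-elim)
open import Data.Fin using (Fin; zero; suc)
open import Data.Integer as ℤ using (ℤ; +_; -[1+_]; +≤+; -≤-; _⊓_)
import Data.Integer.Properties as ℤ
import Data.Integer.Tactic.RingSolver as ℤ-Solver
open import Data.List using (List; []; _∷_; length; map; _++_; filter)
open import Data.List.Membership.Propositional using (_∈_; _∉_)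
open import Data.List.Membership.Propositional.Properties
  using (∈-map⁺; ∈-map⁻; ∈-++⁺ˡ; ∈-++⁺ʳ; ∈-++⁻; ∈-filter⁺; ∈-filter⁻)
open import Data.List.Properties using (length-map; length-++; map-++; map-∘)
open import Data.List.Relation.Unary.All as All using (All; []; _∷_)
import Data.List.Relation.Unary.All.Properties as All
open import Data.List.Relation.Unary.AllPairs using ([]; _∷_)
open import Data.List.Relation.Unary.Any using (here; there)
open import Data.List.Relation.Unary.Unique.Propositional using (Unique)
import Data.List.Relation.Unary.Unique.Propositional.Properties as Unique
open import Data.Nat using (ℕ; suc; _+_; _*_; _≤_; s≤s)
open import Data.Nat.ListAction using (sum)
open import Data.Nat.ListAction.Properties using (sum-++)
import Data.Nat.Properties as ℕ
import Data.Nat.Tactic.RingSolver as ℕ-Solver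
open import Data.Product using (Σ; _×_; _,_; proj₁; proj₂)
open import Data.Sum using (_⊎_; inj₁; inj₂)
open import Function using (_∘_)
open import Relation.Binary.Definitions using (DecidableEquality)
open import Relation.Binary.PropositionalEquality
  using (_≡_; _≢_; refl; sym; trans; cong; cong₂; subst; module ≡-Reasoning)
open import Relation.Nullary using (¬_; yes; no; ¬?)

∈-map-injective⁻ : ∀ {B C : Set} {f : B → C} {x : B} {xs : List B} →
                   (∀ {x y} → f x ≡ f y → x ≡ y) → f x ∈ map f xs → x ∈ xs
∈-map-injective⁻ {f = f} injective fx∈ with ∈-map⁻ f fx∈
... | _ , y∈ , fx≡fy = subst (_∈ _) (sym (injective fx≡fy)) y∈

sum-map-∘ : ∀ {B C : Set} (D : C → ℕ) (f : B → C) (X : List B) → sum (map D (map f X)) ≡ sum (map (D ∘ f) X)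
sum-map-∘ D f X = cong sum (sym (map-∘ X))

m+i≡n∧m≤n+k⇒-k≤i : ∀ {m n k} {i : ℤ} → + m ℤ.+ i ≡ + n → m ≤ n + k → ℤ.- + k ℤ.≤ i
m+i≡n∧m≤n+k⇒-k≤i {i = + _} _ _ = ℤ.neg-≤-pos
m+i≡n∧m≤n+k⇒-k≤i {m} {n} {k} { -[1+ a ]} m-[1+a]≡n m≤n+k =
  ℤ.neg-mono-≤ (+≤+ (ℕ.+-cancelˡ-≤ n (suc a) k (subst (_≤ n + k) m≡n+[1+a] m≤n+k)))
  where
    i≡i+j-j : ∀ i j → i ≡ i ℤ.+ j ℤ.- j
    i≡i+j-j = ℤ-Solver.solve-∀

    m≡n+[1+a] : m ≡ n + suc a
    m≡n+[1+a] = ℤ.+-injective (trans (i≡i+j-j (+ m) -[1+ a ]) (cong (ℤ._+ + suc a) m-[1+a]≡n))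

-k≤i≤n⇒∣i∣≤n : ∀ {k n} {i : ℤ} → ℤ.- + k ℤ.≤ i → i ℤ.≤ + n → k ≤ n → ℤ.∣ i ∣ ≤ n
-k≤i≤n⇒∣i∣≤n {i = + _} _ i≤n _ = ℤ.drop‿+≤+ i≤n
-k≤i≤n⇒∣i∣≤n {suc k} {i = -[1+ a ]} (-≤- a≤k) _ k≤n = ℕ.≤-trans (s≤s a≤k) k≤n

pos-+-* : ∀ z k n → + (z + k * n) ≡ + z ℤ.+ + k ℤ.* + n
pos-+-* z k n = trans (ℤ.pos-+ z (k * n)) (cong (λ u → + z ℤ.+ u) (ℤ.pos-* k n))

module _ {A : Set} where

  go0-injective : ∀ {a} {l r : Tree A} {p q : Pos l} → go0 {a = a} {r = r} p ≡ go0 q → p ≡ q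
  go0-injective refl = refl

  go1-injective : ∀ {a} {l r : Tree A} {p q : Pos r} → go1 {a = a} {l = l} p ≡ go1 q → p ≡ q
  go1-injective refl = refl

  -- Zones containing the root

  ¬⊏here : ∀ {t : Tree A} {w : Pos t} → ¬ (w ⊏ here)
  ¬⊏here (⊑-here , here≢here) = here≢here refl

  here⊏go0 : ∀ {a} {l r : Tree A} {p : Pos l} → here ⊏ go0 {a = a} {r = r} p
  here⊏go0 = ⊑-here , λ ()

  here⊏go1 : ∀ {a} {l r : Tree A} {p : Pos r} → here ⊏ go1 {a = a} {l = l} p
  here⊏go1 = ⊑-here , λ ()

  DownClosed : ∀ {t : Tree A} → List (Pos t) → Set
  DownClosed Z = ∀ {y z} → y ⊑ z → z ∈ Z → y ∈ Z

  -- For a zone containing the root, these are its frontier nodes other than the root.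
  Boundary : ∀ {t : Tree A} → List (Pos t) → Pos t → Set
  Boundary {t} Z y = y ∉ Z × ¬ (Σ (Pos t) λ w → w ⊏ y × w ∉ Z)

  downClosed-isZone : ∀ {t : Tree A} {Z : List (Pos t)} →
                      Unique Z → here ∈ Z → DownClosed Z → IsZone here Z
  downClosed-isZone unique here∈Z closed =
    unique , here∈Z , (λ _ _ → ⊑-here) , λ _ _ _ _ z∈Z _ y⊑z → closed y⊑z z∈Z

  boundary-isFrontier : ∀ {t : Tree A} {Z F : List (Pos t)} → here ∈ Z → Unique F →
                        (∀ {y} → y ∈ F → Boundary Z y) → (∀ {y} → Boundary Z y → y ∈ F) →
                        IsFrontier here Z (here ∷ F)
  boundary-isFrontier {Z = Z} {F} here∈Z unique F⊆boundary boundary⊆F =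
    All.tabulate here≢ ∷ unique , λ y → to , from
    where
      here≢ : ∀ {y} → y ∈ F → here ≢ y
      here≢ y∈F refl = proj₁ (F⊆boundary y∈F) here∈Z

      to : ∀ {y} → y ∈ here ∷ F → InFrontier here Z y
      to (here y≡here) = inj₁ y≡here
      to (there y∈F) with F⊆boundary y∈F
      ... | y∉Z , minimal = inj₂ (⊑-here , y∉Z , λ (w , _ , w⊏y , w∉Z) → minimal (w , w⊏y , w∉Z))

      from : ∀ {y} → InFrontier here Z y → y ∈ here ∷ F
      from (inj₁ y≡here) = here y≡here
      from (inj₂ (_ , y∉Z , minimal)) =
        there (boundary⊆F (y∉Z , λ (w , w⊏y , w∉Z) → minimal (w , ⊑-here , w⊏y , w∉Z)))

  module _ {a : A} {l r : Tree A} where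

    infixr 5 _⋈_

    _⋈_ : List (Pos l) → List (Pos r) → List (Pos (node a l r))
    X ⋈ Y = map go0 X ++ map go1 Y

    length-⋈ : ∀ X Y → length (X ⋈ Y) ≡ length X + length Y
    length-⋈ X Y = trans (length-++ (map go0 X)) (cong₂ _+_ (length-map go0 X) (length-map go1 Y))

    mass-⋈ : ∀ (D : Pos (node a l r) → ℕ) X Y → mass D (X ⋈ Y) ≡ mass (D ∘ go0) X + mass (D ∘ go1) Y
    mass-⋈ D X Y = begin
      sum (map D (map go0 X ++ map go1 Y))              ≡⟨ cong sum (map-++ D (map go0 X) (map go1 Y)) ⟩
      sum (map D (map go0 X) ++ map D (map go1 Y))      ≡⟨ sum-++ (map D (map go0 X)) _ ⟩
      sum (map D (map go0 X)) + sum (map D (map go1 Y)) ≡⟨ cong₂ _+_ (sum-map-∘ D go0 X) (sum-map-∘ D go1 Y) ⟩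
      mass (D ∘ go0) X + mass (D ∘ go1) Y               ∎
      where open ≡-Reasoning

    module _ {X : List (Pos l)} {Y : List (Pos r)} where

      ∈-⋈⁺ˡ : ∀ {y} → y ∈ X → go0 y ∈ X ⋈ Y
      ∈-⋈⁺ˡ = ∈-++⁺ˡ ∘ ∈-map⁺ go0

      ∈-⋈⁺ʳ : ∀ {y} → y ∈ Y → go1 y ∈ X ⋈ Y
      ∈-⋈⁺ʳ = ∈-++⁺ʳ (map go0 X) ∘ ∈-map⁺ go1

      ∈-⋈⁻ˡ : ∀ {y} → go0 y ∈ X ⋈ Y → y ∈ X
      ∈-⋈⁻ˡ y∈ with ∈-++⁻ (map go0 X) y∈
      ... | inj₁ y∈X = ∈-map-injective⁻ go0-injective y∈X
      ... | inj₂ y∈Y with ∈-map⁻ go1 y∈Y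
      ...   | _ , _ , ()

      ∈-⋈⁻ʳ : ∀ {y} → go1 y ∈ X ⋈ Y → y ∈ Y
      ∈-⋈⁻ʳ y∈ with ∈-++⁻ (map go0 X) y∈
      ... | inj₂ y∈Y = ∈-map-injective⁻ go1-injective y∈Y
      ... | inj₁ y∈X with ∈-map⁻ go0 y∈X
      ...   | _ , _ , ()

      here∉⋈ : here ∉ X ⋈ Y
      here∉⋈ here∈ with ∈-++⁻ (map go0 X) here∈
      ... | inj₁ here∈X with ∈-map⁻ go0 here∈X
      ...   | _ , _ , ()
      here∉⋈ here∈ | inj₂ here∈Y with ∈-map⁻ go1 here∈Y
      ...   | _ , _ , ()

      ⋈-unique : Unique X → Unique Y → Unique (X ⋈ Y)
      ⋈-unique uX uY = Unique.++⁺ (Unique.map⁺ go0-injective uX) (Unique.map⁺ go1-injective uY) disjoint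
        where
          disjoint : ∀ {w} → ¬ (w ∈ map go0 X × w ∈ map go1 Y)
          disjoint (w∈X , w∈Y) with ∈-map⁻ go0 w∈X | ∈-map⁻ go1 w∈Y
          ... | _ , _ , refl | _ , _ , ()

      All-⋈⁺ : ∀ {P : Pos (node a l r) → Set} → All (P ∘ go0) X → All (P ∘ go1) Y → All P (X ⋈ Y)
      All-⋈⁺ PX PY = All.++⁺ (All.map⁺ PX) (All.map⁺ PY)

      go0∈⁻ : ∀ {y} → go0 y ∈ here ∷ X ⋈ Y → y ∈ X
      go0∈⁻ (there y∈) = ∈-⋈⁻ˡ y∈

      go1∈⁻ : ∀ {y} → go1 y ∈ here ∷ X ⋈ Y → y ∈ Y
      go1∈⁻ (there y∈) = ∈-⋈⁻ʳ y∈

      boundary-go0⁺ : ∀ {y} → Boundary X y → Boundary (here ∷ X ⋈ Y) (go0 y)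
      boundary-go0⁺ (y∉X , minimal) = y∉X ∘ go0∈⁻ , minimal′
        where
          minimal′ : ¬ (Σ (Pos (node a l r)) λ w → w ⊏ go0 _ × w ∉ here ∷ X ⋈ Y)
          minimal′ (here , _ , here∉) = here∉ (here refl)
          minimal′ (go0 w , (⊑-0 w⊑y , w≢y) , w∉) =
            minimal (w , (w⊑y , w≢y ∘ cong go0) , w∉ ∘ there ∘ ∈-⋈⁺ˡ)

      boundary-go1⁺ : ∀ {y} → Boundary Y y → Boundary (here ∷ X ⋈ Y) (go1 y)
      boundary-go1⁺ (y∉Y , minimal) = y∉Y ∘ go1∈⁻ , minimal′
        where
          minimal′ : ¬ (Σ (Pos (node a l r)) λ w → w ⊏ go1 _ × w ∉ here ∷ X ⋈ Y)
          minimal′ (here , _ , here∉) = here∉ (here refl)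
          minimal′ (go1 w , (⊑-1 w⊑y , w≢y) , w∉) =
            minimal (w , (w⊑y , w≢y ∘ cong go1) , w∉ ∘ there ∘ ∈-⋈⁺ʳ)

      boundary-go0⁻ : ∀ {y} → Boundary (here ∷ X ⋈ Y) (go0 y) → Boundary X y
      boundary-go0⁻ (y∉ , minimal) =
        y∉ ∘ there ∘ ∈-⋈⁺ˡ ,
        λ (w , (w⊑y , w≢y) , w∉X) → minimal (go0 w , (⊑-0 w⊑y , w≢y ∘ go0-injective) , w∉X ∘ go0∈⁻)

      boundary-go1⁻ : ∀ {y} → Boundary (here ∷ X ⋈ Y) (go1 y) → Boundary Y y
      boundary-go1⁻ (y∉ , minimal) =
        y∉ ∘ there ∘ ∈-⋈⁺ʳ ,
        λ (w , (w⊑y , w≢y) , w∉Y) → minimal (go1 w , (⊑-1 w⊑y , w≢y ∘ go1-injective) , w∉Y ∘ go1∈⁻)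

  -- Subtrees

  subtree : (t : Tree A) → Pos t → Tree A
  subtree t here = t
  subtree (node a l r) (go0 p) = subtree l p
  subtree (node a l r) (go1 p) = subtree r p

  graft : ∀ {t : Tree A} (x : Pos t) → Pos (subtree t x) → Pos t
  graft here q = q
  graft (go0 p) q = go0 (graft p q)
  graft (go1 p) q = go1 (graft p q)

  graft-here : ∀ {t : Tree A} (x : Pos t) → graft x here ≡ x
  graft-here here = refl
  graft-here (go0 p) = cong go0 (graft-here p)
  graft-here (go1 p) = cong go1 (graft-here p)

  graft-injective : ∀ {t : Tree A} (x : Pos t) {p q} → graft x p ≡ graft x q → p ≡ q
  graft-injective here eq = eq
  graft-injective (go0 x) eq = graft-injective x (go0-injective eq)
  graft-injective (go1 x) eq = graft-injective x (go1-injective eq)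

  graft-mono : ∀ {t : Tree A} (x : Pos t) {p q} → p ⊑ q → graft x p ⊑ graft x q
  graft-mono here p⊑q = p⊑q
  graft-mono (go0 x) p⊑q = ⊑-0 (graft-mono x p⊑q)
  graft-mono (go1 x) p⊑q = ⊑-1 (graft-mono x p⊑q)

  graft-above : ∀ {t : Tree A} (x : Pos t) {p y} → graft x p ⊑ y →
                Σ (Pos (subtree t x)) λ q → y ≡ graft x q × p ⊑ q
  graft-above here {y = y} p⊑y = y , refl , p⊑y
  graft-above (go0 x) (⊑-0 h) with graft-above x h
  ... | q , refl , p⊑q = q , refl , p⊑q
  graft-above (go1 x) (⊑-1 h) with graft-above x h
  ... | q , refl , p⊑q = q , refl , p⊑q

  module Embedding {s t : Tree A} (ι : Pos s → Pos t)
    (injective : ∀ {p q} → ι p ≡ ι q → p ≡ q)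
    (mono : ∀ {p q} → p ⊑ q → ι p ⊑ ι q)
    (above : ∀ {p y} → ι p ⊑ y → Σ (Pos s) λ q → y ≡ ι q × p ⊑ q)
    where

    reflect : ∀ {p q} → ι p ⊑ ι q → p ⊑ q
    reflect {p} ιp⊑ιq with above ιp⊑ιq
    ... | _ , ιq≡ιq′ , p⊑q′ = subst (p ⊑_) (sym (injective ιq≡ιq′)) p⊑q′

    ⊏-map : ∀ {p q} → p ⊏ q → ι p ⊏ ι q
    ⊏-map (p⊑q , p≢q) = mono p⊑q , p≢q ∘ injective

    ⊏-reflect : ∀ {p q} → ι p ⊏ ι q → p ⊏ q
    ⊏-reflect (ιp⊑ιq , ιp≢ιq) = reflect ιp⊑ιq , ιp≢ιq ∘ cong ι

    ∉-map : ∀ {p Z} → p ∉ Z → ι p ∉ map ι Z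
    ∉-map p∉Z = p∉Z ∘ ∈-map-injective⁻ injective

    isZone-map : ∀ {p Z} → IsZone p Z → IsZone (ι p) (map ι Z)
    isZone-map {p} {Z} (unique , p∈Z , least , convex) =
      Unique.map⁺ injective unique , ∈-map⁺ ι p∈Z , least′ , convex′
      where
        least′ : ∀ z → z ∈ map ι Z → ι p ⊑ z
        least′ z z∈ with ∈-map⁻ ι z∈
        ... | z′ , z′∈Z , refl = mono (least z′ z′∈Z)

        convex′ : ∀ u y z → u ∈ map ι Z → z ∈ map ι Z → u ⊑ y → y ⊑ z → y ∈ map ι Z
        convex′ u y z u∈ z∈ u⊑y y⊑z with ∈-map⁻ ι u∈ | ∈-map⁻ ι z∈
        ... | u′ , u′∈Z , refl | z′ , z′∈Z , refl with above u⊑y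
        ...   | y′ , refl , u′⊑y′ = ∈-map⁺ ι (convex u′ y′ z′ u′∈Z z′∈Z u′⊑y′ (reflect y⊑z))

    inFrontier-map : ∀ {p Z y} → InFrontier p Z y → InFrontier (ι p) (map ι Z) (ι y)
    inFrontier-map (inj₁ y≡p) = inj₁ (cong ι y≡p)
    inFrontier-map {p} {Z} {y} (inj₂ (p⊑y , y∉Z , minimal)) = inj₂ (mono p⊑y , ∉-map y∉Z , minimal′)
      where
        minimal′ : ¬ (Σ (Pos t) λ w → ι p ⊑ w × w ⊏ ι y × w ∉ map ι Z)
        minimal′ (w , ιp⊑w , w⊏ιy , w∉) with above ιp⊑w
        ... | w′ , refl , p⊑w′ = minimal (w′ , p⊑w′ , ⊏-reflect w⊏ιy , w∉ ∘ ∈-map⁺ ι)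

    inFrontier-unmap : ∀ {p Z y} → InFrontier (ι p) (map ι Z) y →
                       Σ (Pos s) λ y′ → y ≡ ι y′ × InFrontier p Z y′
    inFrontier-unmap {p} (inj₁ y≡ιp) = p , y≡ιp , inj₁ refl
    inFrontier-unmap (inj₂ (ιp⊑y , y∉ , minimal)) with above ιp⊑y
    ... | y′ , refl , p⊑y′ =
      y′ , refl , inj₂ (p⊑y′ , y∉ ∘ ∈-map⁺ ι ,
        λ (w , p⊑w , w⊏y′ , w∉Z) → minimal (ι w , mono p⊑w , ⊏-map w⊏y′ , ∉-map w∉Z))

    isFrontier-map : ∀ {p Z F} → IsFrontier p Z F → IsFrontier (ι p) (map ι Z) (map ι F)
    isFrontier-map {p} {Z} {F} (unique , frontier) = Unique.map⁺ injective unique , λ y → to y , from y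
      where
        to : ∀ y → y ∈ map ι F → InFrontier (ι p) (map ι Z) y
        to y y∈ with ∈-map⁻ ι y∈
        ... | y′ , y′∈F , refl = inFrontier-map (proj₁ (frontier y′) y′∈F)

        from : ∀ y → InFrontier (ι p) (map ι Z) y → y ∈ map ι F
        from y h with inFrontier-unmap h
        ... | y′ , refl , h′ = ∈-map⁺ ι (proj₂ (frontier y′) h′)

  -- Definability of nodes by their addresses

  positions : (t : Tree A) → List (Pos t)
  positions (leaf a) = here ∷ []
  positions (node a l r) = here ∷ positions l ⋈ positions r

  ∈-positions : ∀ {t : Tree A} (p : Pos t) → p ∈ positions t
  ∈-positions {leaf a} here = here refl
  ∈-positions {node a l r} here = here refl
  ∈-positions (go0 p) = there (∈-⋈⁺ˡ (∈-positions p))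
  ∈-positions (go1 p) = there (∈-⋈⁺ʳ (∈-positions p))

  address : ∀ {t : Tree A} → Pos t → List Bool
  address here = []
  address (go0 p) = false ∷ address p
  address (go1 p) = true ∷ address p

  data Walk {t : Tree A} : Pos t → List Bool → Pos t → Set where
    stop  : ∀ {x} → Walk x [] x
    step0 : ∀ {x y z w} → Child0 x y → Walk y w z → Walk x (false ∷ w) z
    step1 : ∀ {x y z w} → Child1 x y → Walk y w z → Walk x (true ∷ w) z

  walk-[] : ∀ {t : Tree A} {x y : Pos t} → Walk x [] y → x ≡ y
  walk-[] stop = refl

  walk-go0 : ∀ {a} {l r : Tree A} {x y : Pos l} {w} → Walk x w y → Walk (go0 {a = a} {r = r} x) w (go0 y)
  walk-go0 stop = stop
  walk-go0 (step0 c k) = step0 (c-0 c) (walk-go0 k)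
  walk-go0 (step1 c k) = step1 (c-0 c) (walk-go0 k)

  walk-go1 : ∀ {a} {l r : Tree A} {x y : Pos r} {w} → Walk x w y → Walk (go1 {a = a} {l = l} x) w (go1 y)
  walk-go1 stop = stop
  walk-go1 (step0 c k) = step0 (c-1 c) (walk-go1 k)
  walk-go1 (step1 c k) = step1 (c-1 c) (walk-go1 k)

  walk-address : ∀ {t : Tree A} (p : Pos t) → Walk here (address p) p
  walk-address here = stop
  walk-address (go0 p) = step0 c-here (walk-go0 (walk-address p))
  walk-address (go1 p) = step1 c-here (walk-go1 (walk-address p))

  child0-functional : ∀ {t : Tree A} {x y y′ : Pos t} → Child0 x y → Child0 x y′ → y ≡ y′
  child0-functional c-here c-here = refl
  child0-functional (c-0 c) (c-0 c′) = cong go0 (child0-functional c c′)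
  child0-functional (c-1 c) (c-1 c′) = cong go1 (child0-functional c c′)

  child1-functional : ∀ {t : Tree A} {x y y′ : Pos t} → Child1 x y → Child1 x y′ → y ≡ y′
  child1-functional c-here c-here = refl
  child1-functional (c-0 c) (c-0 c′) = cong go0 (child1-functional c c′)
  child1-functional (c-1 c) (c-1 c′) = cong go1 (child1-functional c c′)

  walk-functional : ∀ {t : Tree A} {x y y′ : Pos t} {w} → Walk x w y → Walk x w y′ → y ≡ y′
  walk-functional stop stop = refl
  walk-functional (step0 c k) (step0 c′ k′) =
    walk-functional k (subst (λ v → Walk v _ _) (sym (child0-functional c c′)) k′)
  walk-functional (step1 c k) (step1 c′ k′) =
    walk-functional k (subst (λ v → Walk v _ _) (sym (child1-functional c c′)) k′)

  HasParent : ∀ {t : Tree A} → Pos t → Set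
  HasParent {t} v = (Σ (Pos t) λ z → Child0 z v) ⊎ (Σ (Pos t) λ z → Child1 z v)

  here-or-hasParent : ∀ {t : Tree A} (v : Pos t) → v ≡ here ⊎ HasParent v
  here-or-hasParent here = inj₁ refl
  here-or-hasParent (go0 v) with here-or-hasParent v
  ... | inj₁ refl = inj₂ (inj₁ (here , c-here))
  ... | inj₂ (inj₁ (z , c)) = inj₂ (inj₁ (go0 z , c-0 c))
  ... | inj₂ (inj₂ (z , c)) = inj₂ (inj₂ (go0 z , c-0 c))
  here-or-hasParent (go1 v) with here-or-hasParent v
  ... | inj₁ refl = inj₂ (inj₂ (here , c-here))
  ... | inj₂ (inj₁ (z , c)) = inj₂ (inj₁ (go1 z , c-1 c))
  ... | inj₂ (inj₂ (z , c)) = inj₂ (inj₂ (go1 z , c-1 c))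

  Path : ∀ {n m} → List Bool → Fin n → Fin n → Formula A n m
  Path [] i j = equal i j
  Path (false ∷ w) i j = ex1 (conj (child0 (suc i) zero) (Path w zero (suc j)))
  Path (true ∷ w) i j = ex1 (conj (child1 (suc i) zero) (Path w zero (suc j)))

  Root : ∀ {n m} → Fin n → Formula A n m
  Root i = conj (neg (ex1 (child0 zero (suc i)))) (neg (ex1 (child1 zero (suc i))))

  IsAt : ∀ {t : Tree A} → Pos t → Formula A 1 0
  IsAt p = ex1 (conj (Root zero) (Path (address p) zero (suc zero)))

  Avoids : ∀ {t : Tree A} → List (Pos t) → Formula A 1 0
  Avoids [] = equal zero zero
  Avoids (p ∷ ps) = conj (neg (IsAt p)) (Avoids ps)

  module _ {t : Tree A} where

    path-sound : ∀ {n m} w (i j : Fin n) (ρ : Fin n → Pos t) (σ : Fin m → List (Pos t)) →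
                 Sat t (Path w i j) ρ σ → Walk (ρ i) w (ρ j)
    path-sound [] i j ρ σ ρi≡ρj = subst (Walk (ρ i) []) ρi≡ρj stop
    path-sound (false ∷ w) i j ρ σ (v , c , s) = step0 c (path-sound w zero (suc j) (ext ρ v) σ s)
    path-sound (true ∷ w) i j ρ σ (v , c , s) = step1 c (path-sound w zero (suc j) (ext ρ v) σ s)

    path-complete : ∀ {n m} w (i j : Fin n) (ρ : Fin n → Pos t) (σ : Fin m → List (Pos t)) →
                    Walk (ρ i) w (ρ j) → Sat t (Path w i j) ρ σ
    path-complete [] i j ρ σ k = walk-[] k
    path-complete (false ∷ w) i j ρ σ (step0 {y = v} c k) = v , c , path-complete w zero (suc j) (ext ρ v) σ k
    path-complete (true ∷ w) i j ρ σ (step1 {y = v} c k) = v , c , path-complete w zero (suc j) (ext ρ v) σ k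

    isAt-sound : ∀ (p u : Pos t) → Sat t (IsAt p) (λ _ → u) noSets → u ≡ p
    isAt-sound p u (v , (no-parent0 , no-parent1) , s) with here-or-hasParent v
    ... | inj₁ refl = walk-functional (path-sound (address p) zero (suc zero) _ noSets s) (walk-address p)
    ... | inj₂ (inj₁ parent) = ⊥-elim (no-parent0 parent)
    ... | inj₂ (inj₂ parent) = ⊥-elim (no-parent1 parent)

    isAt-complete : ∀ (p : Pos t) → Sat t (IsAt p) (λ _ → p) noSets
    isAt-complete p =
      here , ((λ ()) , (λ ())) , path-complete (address p) zero (suc zero) _ noSets (walk-address p)

    avoids-sound : ∀ (L : List (Pos t)) u → Sat t (Avoids L) (λ _ → u) noSets → u ∉ L
    avoids-sound (p ∷ ps) u (u≢p , _) (here refl) = u≢p (isAt-complete p)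
    avoids-sound (p ∷ ps) u (_ , s) (there u∈ps) = avoids-sound ps u s u∈ps

    avoids-complete : ∀ (L : List (Pos t)) u → u ∉ L → Sat t (Avoids L) (λ _ → u) noSets
    avoids-complete [] u _ = refl
    avoids-complete (p ∷ ps) u u∉ =
      (λ s → u∉ (here (isAt-sound p u s))) , avoids-complete ps u (u∉ ∘ there)

  wmsoDefinable : ∀ {B : Set} → DecidableEquality B → (t : Tree A) (g : Pos t → B) → WMSODefinable t g
  wmsoDefinable {B} _≟_ t g =
    map g (positions t) , (λ u → ∈-map⁺ g (∈-positions u)) ,
    λ i _ → Avoids (others i) , λ u → sound i u , complete i u
    where
      others : B → List (Pos t)
      others i = filter (λ p → ¬? (g p ≟ i)) (positions t)

      sound : ∀ i u → Sat t (Avoids (others i)) (λ _ → u) noSets → g u ≡ i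
      sound i u s with g u ≟ i
      ... | yes gu≡i = gu≡i
      ... | no gu≢i =
        ⊥-elim (avoids-sound (others i) u s (∈-filter⁺ (λ p → ¬? (g p ≟ i)) (∈-positions u) gu≢i))

      complete : ∀ i u → g u ≡ i → Sat t (Avoids (others i)) (λ _ → u) noSets
      complete i u gu≡i =
        avoids-complete (others i) u
          λ u∈ → proj₂ (∈-filter⁻ (λ p → ¬? (g p ≟ i)) {xs = positions t} u∈) gu≡i

module Flow {A : Set} (K : ℕ) where

  capped : ℤ → ℤ
  capped v = v ⊓ + K

  rootFlow : (s : Tree A) → (Pos s → ℕ) → ℤ
  rootFlow (leaf a) D = + 1 ℤ.- + D here
  rootFlow (node a l r) D =
    + 1 ℤ.- + D here ℤ.+ capped (rootFlow l (D ∘ go0)) ℤ.+ capped (rootFlow r (D ∘ go1))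

  flow : (s : Tree A) → (Pos s → ℕ) → Pos s → ℤ
  flow s D here = rootFlow s D
  flow (node a l r) D (go0 p) = flow l (D ∘ go0) p
  flow (node a l r) D (go1 p) = flow r (D ∘ go1) p

  flow-subtree : ∀ {t : Tree A} {D : Pos t → ℕ} (x : Pos t) →
                 flow t D x ≡ rootFlow (subtree t x) (D ∘ graft x)
  flow-subtree here = refl
  flow-subtree {node a l r} (go0 p) = flow-subtree {l} p
  flow-subtree {node a l r} (go1 p) = flow-subtree {r} p

  flow-graft : ∀ {t : Tree A} {D : Pos t → ℕ} (x : Pos t) q →
               flow t D (graft x q) ≡ flow (subtree t x) (D ∘ graft x) q
  flow-graft here q = refl
  flow-graft {node a l r} (go0 p) q = flow-graft {l} p q
  flow-graft {node a l r} (go1 p) q = flow-graft {r} p q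

  d+[1-d]≡1 : ∀ (d : ℤ) → d ℤ.+ (+ 1 ℤ.- d) ≡ + 1
  d+[1-d]≡1 = ℤ-Solver.solve-∀

  compatible-inner : ∀ {s : Tree A} {D : Pos s → ℕ} {x y z : Pos s} → Child0 x y → Child1 x z →
                     + D x ℤ.+ flow s D x ℤ.≤ + 1 ℤ.+ flow s D y ℤ.+ flow s D z
  compatible-inner {node a l r} {D} c-here c-here = begin
    + D here ℤ.+ (+ 1 ℤ.- + D here ℤ.+ capped f₀ ℤ.+ capped f₁)
      ≡⟨ cancel (+ D here) (capped f₀) (capped f₁) ⟩
    + 1 ℤ.+ capped f₀ ℤ.+ capped f₁
      ≤⟨ ℤ.+-mono-≤ (ℤ.+-monoʳ-≤ (+ 1) (ℤ.i⊓j≤i f₀ _)) (ℤ.i⊓j≤i f₁ _) ⟩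
    + 1 ℤ.+ f₀ ℤ.+ f₁
      ∎
    where
      open ℤ.≤-Reasoning
      f₀ = rootFlow l (D ∘ go0)
      f₁ = rootFlow r (D ∘ go1)
      cancel : ∀ d c₀ c₁ → d ℤ.+ (+ 1 ℤ.- d ℤ.+ c₀ ℤ.+ c₁) ≡ + 1 ℤ.+ c₀ ℤ.+ c₁
      cancel = ℤ-Solver.solve-∀
  compatible-inner (c-0 c₀) (c-0 c₁) = compatible-inner c₀ c₁
  compatible-inner (c-1 c₀) (c-1 c₁) = compatible-inner c₀ c₁

  compatible-leaf : ∀ {s : Tree A} {D : Pos s → ℕ} {x : Pos s} → IsLeaf x → + D x ℤ.+ flow s D x ≡ + 1
  compatible-leaf {D = D} l-here = d+[1-d]≡1 (+ D here)
  compatible-leaf (l-0 x-leaf) = compatible-leaf x-leaf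
  compatible-leaf (l-1 x-leaf) = compatible-leaf x-leaf

  flow-compatible : ∀ {t : Tree A} (D : Pos t → ℕ) → Compatible t D (flow t D)
  flow-compatible D = (λ _ _ _ → compatible-inner) , λ _ x-leaf → ℤ.≤-reflexive (compatible-leaf x-leaf)

  flow-≤ : ∀ {s : Tree A} {D : Pos s → ℕ} (x : Pos s) → flow s D x ℤ.≤ + (2 * K + 1)
  flow-≤ {leaf a} {D} here = ℤ.≤-trans (ℤ.i-j≤i (+ 1) (+ D here)) (+≤+ (ℕ.m≤n+m 1 (2 * K)))
  flow-≤ {node a l r} {D} here = begin
    + 1 ℤ.- + D here ℤ.+ capped _ ℤ.+ capped _
      ≤⟨ ℤ.+-mono-≤ (ℤ.+-mono-≤ (ℤ.i-j≤i (+ 1) (+ D here)) (ℤ.i⊓j≤j _ _)) (ℤ.i⊓j≤j _ _) ⟩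
    + (1 + K + K)
      ≡⟨ cong +_ (1+k+k≡2k+1 K) ⟩
    + (2 * K + 1)
      ∎
    where
      open ℤ.≤-Reasoning
      1+k+k≡2k+1 : ∀ k → 1 + k + k ≡ 2 * k + 1
      1+k+k≡2k+1 = ℕ-Solver.solve-∀
  flow-≤ {node a l r} (go0 p) = flow-≤ p
  flow-≤ {node a l r} (go1 p) = flow-≤ p

  -- `outflow` is what the root passes to its parent: its flow when Z contains
  -- it, and exactly K for the empty cut.
  record Cut (s : Tree A) (D : Pos s → ℕ) (outflow : ℤ) : Set where
    field
      Z F : List (Pos s)
      Z-unique : Unique Z
      F-unique : Unique F
      Z-downClosed : DownClosed Z
      F⊆boundary : ∀ {y} → y ∈ F → Boundary Z y
      boundary⊆F : ∀ {y} → Boundary Z y → y ∈ F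
      balanced : + mass D Z ℤ.+ outflow ≡ + (length Z + K * length F)
      F-saturated : All (λ y → + K ℤ.≤ flow s D y) F

  emptyCut : ∀ {s : Tree A} {D : Pos s → ℕ} → + K ℤ.≤ rootFlow s D → Cut s D (+ K)
  emptyCut {s} K≤f = record
    { Z = []
    ; F = here ∷ []
    ; Z-unique = []
    ; F-unique = [] ∷ []
    ; Z-downClosed = λ _ ()
    ; F⊆boundary = λ { (here refl) → (λ ()) , λ (_ , w⊏here , _) → ¬⊏here w⊏here }
    ; boundary⊆F = complete
    ; balanced = cong +_ (sym (ℕ.*-identityʳ K))
    ; F-saturated = K≤f ∷ []
    }
    where
      complete : ∀ {y : Pos s} → Boundary [] y → y ∈ here ∷ []
      complete {here} _ = here refl
      complete {go0 _} (_ , minimal) = ⊥-elim (minimal (here , here⊏go0 , λ ()))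
      complete {go1 _} (_ , minimal) = ⊥-elim (minimal (here , here⊏go1 , λ ()))

  leafCut : ∀ {a} {D : Pos (leaf a) → ℕ} → Cut (leaf a) D (+ 1 ℤ.- + D here)
  leafCut {D = D} = record
    { Z = here ∷ []
    ; F = []
    ; Z-unique = [] ∷ []
    ; F-unique = []
    ; Z-downClosed = λ { {here} _ _ → here refl }
    ; F⊆boundary = λ ()
    ; boundary⊆F = λ { {here} (here∉ , _) → ⊥-elim (here∉ (here refl)) }
    ; balanced = begin
        + (D here + 0) ℤ.+ (+ 1 ℤ.- + D here)
          ≡⟨ cong (λ n → + n ℤ.+ (+ 1 ℤ.- + D here)) (ℕ.+-identityʳ (D here)) ⟩
        + D here ℤ.+ (+ 1 ℤ.- + D here)
          ≡⟨ d+[1-d]≡1 (+ D here) ⟩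
        + 1
          ≡⟨ cong (λ n → + (1 + n)) (sym (ℕ.*-zeroʳ K)) ⟩
        + (1 + K * 0)
          ∎
    ; F-saturated = []
    }
    where open ≡-Reasoning

  node-balanced : ∀ d m₀ m₁ z₀ z₁ f₀ f₁ (c₀ c₁ : ℤ) →
                  + m₀ ℤ.+ c₀ ≡ + (z₀ + K * f₀) → + m₁ ℤ.+ c₁ ≡ + (z₁ + K * f₁) →
                  + (d + (m₀ + m₁)) ℤ.+ (+ 1 ℤ.- + d ℤ.+ c₀ ℤ.+ c₁) ≡ + (suc (z₀ + z₁) + K * (f₀ + f₁))
  node-balanced d m₀ m₁ z₀ z₁ f₀ f₁ c₀ c₁ b₀ b₁ = begin
    + (d + (m₀ + m₁)) ℤ.+ (+ 1 ℤ.- + d ℤ.+ c₀ ℤ.+ c₁)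
      ≡⟨ cong (ℤ._+ (+ 1 ℤ.- + d ℤ.+ c₀ ℤ.+ c₁))
           (trans (ℤ.pos-+ d _) (cong (λ u → + d ℤ.+ u) (ℤ.pos-+ m₀ m₁))) ⟩
    + d ℤ.+ (+ m₀ ℤ.+ + m₁) ℤ.+ (+ 1 ℤ.- + d ℤ.+ c₀ ℤ.+ c₁)
      ≡⟨ regroup (+ d) (+ m₀) (+ m₁) c₀ c₁ ⟩
    + 1 ℤ.+ ((+ m₀ ℤ.+ c₀) ℤ.+ (+ m₁ ℤ.+ c₁))
      ≡⟨ cong₂ (λ u v → + 1 ℤ.+ (u ℤ.+ v)) b₀ b₁ ⟩
    + (1 + ((z₀ + K * f₀) + (z₁ + K * f₁)))
      ≡⟨ cong +_ (regroupℕ z₀ z₁ K f₀ f₁) ⟩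
    + (suc (z₀ + z₁) + K * (f₀ + f₁))
      ∎
    where
      open ≡-Reasoning
      regroup : ∀ d m₀ m₁ c₀ c₁ →
                d ℤ.+ (m₀ ℤ.+ m₁) ℤ.+ (+ 1 ℤ.- d ℤ.+ c₀ ℤ.+ c₁) ≡ + 1 ℤ.+ ((m₀ ℤ.+ c₀) ℤ.+ (m₁ ℤ.+ c₁))
      regroup = ℤ-Solver.solve-∀
      regroupℕ : ∀ z₀ z₁ k f₀ f₁ → 1 + ((z₀ + k * f₀) + (z₁ + k * f₁)) ≡ suc (z₀ + z₁) + k * (f₀ + f₁)
      regroupℕ = ℕ-Solver.solve-∀

  nodeCut : ∀ {a} {l r : Tree A} {D : Pos (node a l r) → ℕ} {c₀ c₁} →
            Cut l (D ∘ go0) c₀ → Cut r (D ∘ go1) c₁ → Cut (node a l r) D (+ 1 ℤ.- + D here ℤ.+ c₀ ℤ.+ c₁)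
  nodeCut {D = D} {c₀} {c₁} C₀ C₁ = record
    { Z = here ∷ C₀.Z ⋈ C₁.Z
    ; F = C₀.F ⋈ C₁.F
    ; Z-unique = All-⋈⁺ {X = C₀.Z} {Y = C₁.Z} (All.tabulate λ _ ()) (All.tabulate λ _ ())
                 ∷ ⋈-unique C₀.Z-unique C₁.Z-unique
    ; F-unique = ⋈-unique C₀.F-unique C₁.F-unique
    ; Z-downClosed = closed
    ; F⊆boundary = sound
    ; boundary⊆F = complete
    ; balanced = begin
        + mass D (here ∷ C₀.Z ⋈ C₁.Z) ℤ.+ (+ 1 ℤ.- + D here ℤ.+ c₀ ℤ.+ c₁)
          ≡⟨ cong (λ m → + (D here + m) ℤ.+ (+ 1 ℤ.- + D here ℤ.+ c₀ ℤ.+ c₁)) (mass-⋈ D C₀.Z C₁.Z) ⟩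
        + (D here + (mass (D ∘ go0) C₀.Z + mass (D ∘ go1) C₁.Z)) ℤ.+ (+ 1 ℤ.- + D here ℤ.+ c₀ ℤ.+ c₁)
          ≡⟨ node-balanced (D here) _ _ _ _ _ _ c₀ c₁ C₀.balanced C₁.balanced ⟩
        + (suc (length C₀.Z + length C₁.Z) + K * (length C₀.F + length C₁.F))
          ≡⟨ sym (cong₂ (λ z f → + (suc z + K * f)) (length-⋈ C₀.Z C₁.Z) (length-⋈ C₀.F C₁.F)) ⟩
        + (length (here ∷ C₀.Z ⋈ C₁.Z) + K * length (C₀.F ⋈ C₁.F))
          ∎
    ; F-saturated = All-⋈⁺ C₀.F-saturated C₁.F-saturated
    }
    where
      module C₀ = Cut C₀
      module C₁ = Cut C₁
      open ≡-Reasoning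

      closed : DownClosed (here ∷ C₀.Z ⋈ C₁.Z)
      closed ⊑-here _ = here refl
      closed (⊑-0 y⊑z) z∈ = there (∈-⋈⁺ˡ (C₀.Z-downClosed y⊑z (go0∈⁻ z∈)))
      closed (⊑-1 y⊑z) z∈ = there (∈-⋈⁺ʳ (C₁.Z-downClosed y⊑z (go1∈⁻ z∈)))

      sound : ∀ {y} → y ∈ C₀.F ⋈ C₁.F → Boundary (here ∷ C₀.Z ⋈ C₁.Z) y
      sound {here} here∈ = ⊥-elim (here∉⋈ {X = C₀.F} {Y = C₁.F} here∈)
      sound {go0 _} y∈ = boundary-go0⁺ (C₀.F⊆boundary (∈-⋈⁻ˡ y∈))
      sound {go1 _} y∈ = boundary-go1⁺ (C₁.F⊆boundary (∈-⋈⁻ʳ y∈))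

      complete : ∀ {y} → Boundary (here ∷ C₀.Z ⋈ C₁.Z) y → y ∈ C₀.F ⋈ C₁.F
      complete {here} (here∉ , _) = ⊥-elim (here∉ (here refl))
      complete {go0 _} b = ∈-⋈⁺ˡ (C₀.boundary⊆F (boundary-go0⁻ b))
      complete {go1 _} b = ∈-⋈⁺ʳ (C₁.boundary⊆F (boundary-go1⁻ b))

  rootCut : (s : Tree A) (D : Pos s → ℕ) → Cut s D (rootFlow s D)
  cappedCut : (s : Tree A) (D : Pos s → ℕ) → Cut s D (capped (rootFlow s D))

  rootCut (leaf a) D = leafCut
  rootCut (node a l r) D = nodeCut (cappedCut l (D ∘ go0)) (cappedCut r (D ∘ go1))

  cappedCut s D with rootFlow s D ℤ.≤? + K
  ... | yes f≤K = subst (Cut s D) (sym (ℤ.i≤j⇒i⊓j≡i f≤K)) (rootCut s D)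
  ... | no f≰K = subst (Cut s D) (sym (ℤ.i≥j⇒i⊓j≡j K≤f)) (emptyCut K≤f)
    where K≤f = ℤ.<⇒≤ (ℤ.≰⇒> f≰K)

  here∈rootCut : (s : Tree A) (D : Pos s → ℕ) → here ∈ Cut.Z (rootCut s D)
  here∈rootCut (leaf a) D = here refl
  here∈rootCut (node a l r) D = here refl

  module ZoneAt {t : Tree A} (D : Pos t → ℕ) (x : Pos t) where
    open Cut (rootCut (subtree t x) (D ∘ graft x))
    open Embedding (graft x) (graft-injective x) (graft-mono x) (graft-above x)

    zone frontier : List (Pos t)
    zone = map (graft x) Z
    frontier = map (graft x) F

    zone-isZone : IsZone x zone
    zone-isZone = subst (λ p → IsZone p zone) (graft-here x)
      (isZone-map (downClosed-isZone Z-unique (here∈rootCut _ _) Z-downClosed))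

    zone-isFrontier : IsFrontier x zone (x ∷ frontier)
    zone-isFrontier = subst (λ p → IsFrontier p zone (p ∷ frontier)) (graft-here x)
      (isFrontier-map (boundary-isFrontier (here∈rootCut _ _) F-unique F⊆boundary boundary⊆F))

    zone-balanced : + mass D zone ℤ.+ flow t D x ≡ + (length zone + K * length frontier)
    zone-balanced = begin
      + mass D zone ℤ.+ flow t D x
        ≡⟨ cong₂ (λ m v → + m ℤ.+ v) (sum-map-∘ D (graft x) Z) (flow-subtree x) ⟩
      + mass (D ∘ graft x) Z ℤ.+ rootFlow (subtree t x) (D ∘ graft x)
        ≡⟨ balanced ⟩
      + (length Z + K * length F)
        ≡⟨ sym (cong₂ (λ z f → + (z + K * f)) (length-map (graft x) Z) (length-map (graft x) F)) ⟩
      + (length zone + K * length frontier)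
        ∎
      where open ≡-Reasoning

    frontier-saturated : All (λ y → + K ℤ.≤ flow t D y) frontier
    frontier-saturated = All.map⁺ (All.map (λ {q} → subst (+ K ℤ.≤_) (sym (flow-graft x q))) F-saturated)

  flow-≥ : ∀ {t : Tree A} {D : Pos t → ℕ} → Sparse t K D → (x : Pos t) → ℤ.- + K ℤ.≤ flow t D x
  flow-≥ {t} {D} sparse x = m+i≡n∧m≤n+k⇒-k≤i zone-balanced
    (subst (mass D zone ≤_) (regroup (length zone) K (length frontier))
      (sparse x zone (x ∷ frontier) zone-isZone zone-isFrontier))
    where
      open ZoneAt D x
      regroup : ∀ z k f → z + k * suc f ≡ z + k * f + k
      regroup = ℕ-Solver.solve-∀

  flow-bounded : ∀ {t : Tree A} {D : Pos t → ℕ} → Sparse t K D → BoundedBy t (2 * K + 1) (flow t D)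
  flow-bounded sparse x =
    -k≤i≤n⇒∣i∣≤n (flow-≥ sparse x) (flow-≤ x) (ℕ.≤-trans (ℕ.m≤m+n K (K + 0)) (ℕ.m≤m+n (2 * K) 1))

lemma6p15 : {A : Set} (t : Tree A) (K : ℕ) (D : Pos t → ℕ) →
    WMSODefinable t D → Sparse t K D →
    Σ (Pos t → ℤ) λ f →
      WMSODefinable t f × Compatible t D f × BoundedBy t (2 * K + 1) f ×
      (∀ (x : Pos t) → Σ (List (Pos t)) λ Z → Σ (List (Pos t)) λ F →
        IsZone x Z × IsFrontier x Z F ×
        ((+ mass D Z) ℤ.+ f x ≡ (+ length Z) ℤ.+ (+ K) ℤ.* ((+ length F) ℤ.- + 1)) ×
        (∀ y → y ∈ F → y ≢ x → + K ℤ.≤ f y))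
lemma6p15 t K D _ sparse =
  flow t D , wmsoDefinable ℤ._≟_ t (flow t D) , flow-compatible D , flow-bounded sparse , λ x →
    let open ZoneAt D x in
    zone , x ∷ frontier , zone-isZone , zone-isFrontier ,
    trans zone-balanced (pos-+-* (length zone) K (length frontier)) , saturated x
  where
    open Flow K

    saturated : ∀ x y → y ∈ x ∷ ZoneAt.frontier D x → y ≢ x → + K ℤ.≤ flow t D y
    saturated x y (here y≡x) y≢x = ⊥-elim (y≢x y≡x)
    saturated x y (there y∈) _ = All.lookup (ZoneAt.frontier-saturated D x) y∈
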